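{- Let $m\ge 1$ be fixed and $\sigma\in\mathfrak{S}_m$. If the sequence of random permutations $\sigma\otimes\rho_n$ ($n\to\infty$) is asymptotically $2$-symmetric, then $\sigma$ is $2$-symmetric, i.e. ${\bf X}^{(12)}(\sigma)={\bf X}^{(21)}(\sigma)=m(m-1)/4$.
   Context: $\mathfrak{S}_n$ is the symmetric group on $[n]$. For $\tau\in\mathfrak{S}_k$ and $\sigma\in\mathfrak{S}_n$, ${\bf X}^\tau(\sigma)$ is the number of $k$-subsets $S\subseteq[n]$ such that for all $i,j\in S$, $\sigma(i)<\sigma(j)$ iff $\tau(i')<\tau(j')$, where $i',j'$ are the ranks of $i,j$ in $S$ (i.e. the number of occurrences of $\tau$ as a pattern in $\sigma$). $\sigma$ is $k$-symmetric if ${\bf X}^\tau(\sigma)$ is the same for all $\tau\in\mathfrak{S}_k$. A sequence $\sigma_i\in\mathfrak{S}_{N_i}$ with $N_i\to\infty$ is asymptotically $k$-symmetric if $k!^2{\bf X}^\tau(\sigma_i)/N_i^k\to 1$ for every $\tau\in\mathfrak{S}_k$ (for random permutations, convergence in probability). Tensor product: viewing permutations as bijections of $\{0,\dots,n-1\}$, for $\pi_1\in\mathfrak{S}_a,\pi_2\in\mathfrak{S}_b$, $\pi_1\otimes\pi_2\in\mathfrak{S}_{ab}$ is $(\pi_1\otimes\pi_2)(j)=b\,\pi_1(\lfloor j/b\rfloor)+\pi_2(j \bmod b)$ (Kronecker product of permutation matrices). $\rho_n$ is a uniformly random element of $\mathfrak{S}_n$. -}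

module Defs where

open import Data.Nat.Base using (ℕ; zero; suc; _+_; _*_; _<_; _≤_; _<ᵇ_; ∣_-_∣; _!)
open import Data.List.Base using (List; []; _∷_; map; concatMap; length; filterᵇ; upTo)
open import Data.List.Relation.Binary.Permutation.Propositional using (_↭_)
open import Data.Product using (Σ; _×_)

-- A permutation of [n] = {0,…,n-1} in one-line notation is a list σ with
-- σ ↭ upTo n; entry at position i is σ(i).
IsPerm : ℕ → List ℕ → Set
IsPerm n σ = σ ↭ upTo n

X12 : List ℕ → ℕ
X12 []       = 0
X12 (x ∷ xs) = length (filterᵇ (x <ᵇ_) xs) + X12 xs

X21 : List ℕ → ℕ
X21 []       = 0
X21 (x ∷ xs) = length (filterᵇ (_<ᵇ x) xs) + X21 xs

-- Enumeration of all permutations of a list (by insertion); each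
-- permutation of [n] appears exactly once in allPerms n (n! entries).
insertAll : ℕ → List ℕ → List (List ℕ)
insertAll x []       = (x ∷ []) ∷ []
insertAll x (y ∷ ys) = (x ∷ y ∷ ys) ∷ map (y ∷_) (insertAll x ys)

perms : List ℕ → List (List ℕ)
perms []       = [] ∷ []
perms (x ∷ xs) = concatMap (insertAll x) (perms xs)

allPerms : ℕ → List (List ℕ)
allPerms n = perms (upTo n)

-- Tensor product σ ⊗ ρ for σ ∈ S_m, ρ ∈ S_n (one-line notation):
-- (σ ⊗ ρ)(j) = n·σ(⌊j/n⌋) + ρ(j mod n).
tensor : ℕ → List ℕ → List ℕ → List ℕ
tensor n σ ρ = concatMap (λ s → map (λ r → n * s + r) ρ) σ

-- For a statistic X on S_N (N = m·n), "2!^2 · X(σ⊗ρ_n) / N^2 → 1 in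
-- probability" with ρ_n uniform on S_n, written exactly in ℕ:
-- for every ε = p/q > 0 and every δ = a/b > 0 there is n₀ such that for
-- all n ≥ n₀ (n ≥ 1), the proportion of ρ ∈ S_n with
-- |4·X(σ⊗ρ)/N^2 − 1| > ε, i.e. q·|4X − N^2| > p·N^2, is < δ, i.e.
-- (#bad)·b < a·n!.
badCount : (List ℕ → ℕ) → ℕ → List ℕ → ℕ → ℕ → ℕ → ℕ
badCount X m σ p q n =
  let N2 = (m * n) * (m * n) in
  length (filterᵇ (λ ρ → (p * N2) <ᵇ (q * ∣ 4 * X (tensor n σ ρ) - N2 ∣))
                  (allPerms n))

ConvInProbTo1 : (List ℕ → ℕ) → ℕ → List ℕ → Set
ConvInProbTo1 X m σ =
  ∀ (p q a b : ℕ) → 0 < p → 0 < q → 0 < a → 0 < b →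
  Σ ℕ λ n₀ → ∀ n → n₀ ≤ n → 1 ≤ n →
    badCount X m σ p q n * b < a * (n !)

AsympTwoSymTensor : ℕ → List ℕ → Set
AsympTwoSymTensor m σ = ConvInProbTo1 X12 m σ × ConvInProbTo1 X21 m σ

module Submission where

-- Write m = |σ|, x = X^{12}(σ), N = m·n and T(ρ) = 4·X^{12}(σ ⊗ ρ).
-- Cutting σ ⊗ ρ into m blocks of length n gives the exact formula
--     X^{12}(σ ⊗ ρ) = n²·x + m·X^{12}(ρ),
-- and averaging over all n! permutations ρ (the mean of X^{12} on S_n is
-- n(n-1)/4) shows that the total  S = Σ_ρ T(ρ)  satisfies
--     S + m·n!·n = n!·n²·(4x) + m·n!·n².
-- Hence, if 4x ≠ m(m-1) and n ≥ 2m, the total S is at distance at least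
-- n!·n²/2 from n!·N².  On the other hand, asymptotic 2-symmetry with
-- tolerance ε = 1/(4m²) and confidence δ = 1/(32m²) lets us choose n such
-- that all but a fraction δ of the ρ have |T(ρ) − N²| ≤ εN², while every ρ has
-- |T(ρ) − N²| ≤ 4N²; summing these bounds puts S within 3·n!·n²/8 of
-- n!·N², a contradiction.  So 4x = m(m-1), and X^{12} + X^{21} = m(m-1)/2 gives the rest.

open import Defs
open import Data.Nat.Base
  using (ℕ; zero; suc; _+_; _*_; _∸_; _≤_; _<_; _<ᵇ_; ∣_-_∣; _!; z≤n; s≤s; z<s)
open import Data.Nat.Properties
open import Data.Nat.Tactic.RingSolver using (solve-∀)
open import Data.Bool.Base using (Bool; true; false; T)
open import Data.Bool.Properties using (T?)
open import Data.Unit.Base using (tt)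
open import Data.Empty using (⊥-elim)
open import Data.Product using (Σ; _×_; _,_; proj₁; proj₂)
open import Data.Sum using (inj₁; inj₂)
open import Function using (id; _∘_)
open import Relation.Nullary using (yes; no)
open import Relation.Binary.Definitions using (tri<; tri≈; tri>)
open import Relation.Binary.PropositionalEquality
open import Data.List.Base
  using (List; []; _∷_; map; concatMap; length; filterᵇ; upTo; _++_)
open import Data.List.Properties using (length-++; length-map; length-upTo; filter-++; length-filter)
open import Data.List.Relation.Unary.All as All using (All; []; _∷_)
open import Data.List.Relation.Unary.All.Properties using (map⁺; concat⁺; applyUpTo⁺₁)
open import Data.List.Relation.Unary.AllPairs using (AllPairs; []; _∷_)
import Data.List.Relation.Unary.AllPairs.Properties as AllPairs
open import Data.List.Relation.Unary.Unique.Propositional using (Unique)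
open import Data.List.Relation.Unary.Unique.Propositional.Properties using (upTo⁺)
import Data.List.Relation.Binary.Permutation.Setoid.Properties as SetoidPerm
open import Data.List.Relation.Binary.Permutation.Propositional using (↭-sym; ↭⇒↭ₛ)
open import Data.List.Relation.Binary.Permutation.Propositional.Properties using (↭-length)

-- Finite sums and boolean counts over lists

sumOver : {A : Set} → (A → ℕ) → List A → ℕ
sumOver f []       = 0
sumOver f (x ∷ xs) = f x + sumOver f xs

indicator : Bool → ℕ
indicator true  = 1
indicator false = 0

countᵇ : {A : Set} → (A → Bool) → List A → ℕ
countᵇ P xs = length (filterᵇ P xs)

module _ {A : Set} where

  sumOver-++ : (f : A → ℕ) (xs ys : List A) → sumOver f (xs ++ ys) ≡ sumOver f xs + sumOver f ys
  sumOver-++ f []       ys = refl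
  sumOver-++ f (x ∷ xs) ys = trans (cong (f x +_) (sumOver-++ f xs ys)) (sym (+-assoc (f x) _ _))

  sumOver-const : {f : A → ℕ} {c : ℕ} {L : List A} → All (λ a → f a ≡ c) L → sumOver f L ≡ length L * c
  sumOver-const []       = refl
  sumOver-const (e ∷ es) = cong₂ _+_ e (sumOver-const es)

  sumOver-scale : (c : ℕ) (f : A → ℕ) (L : List A) → sumOver (λ a → c * f a) L ≡ c * sumOver f L
  sumOver-scale c f []      = sym (*-zeroʳ c)
  sumOver-scale c f (x ∷ L) = trans (cong (c * f x +_) (sumOver-scale c f L)) (sym (*-distribˡ-+ c (f x) _))

  sumOver-affine : {f g : A → ℕ} (c d : ℕ) {L : List A} → All (λ a → f a ≡ c + d * g a) L →
                   sumOver f L ≡ length L * c + d * sumOver g L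
  sumOver-affine c d      {[]}     []       = sym (*-zeroʳ d)
  sumOver-affine {f} {g} c d {x ∷ xs} (e ∷ es) = begin
      f x + sumOver f xs                                  ≡⟨ cong₂ _+_ e (sumOver-affine c d es) ⟩
      (c + d * g x) + (length xs * c + d * sumOver g xs)  ≡⟨ regroup c d (g x) (length xs) (sumOver g xs) ⟩
      suc (length xs) * c + d * (g x + sumOver g xs)      ∎
    where
      open ≡-Reasoning
      regroup : ∀ c d y l s → (c + d * y) + (l * c + d * s) ≡ suc l * c + d * (y + s)
      regroup = solve-∀

  countᵇ-cons : (P : A → Bool) (y : A) (ys : List A) → countᵇ P (y ∷ ys) ≡ indicator (P y) + countᵇ P ys
  countᵇ-cons P y ys with P y
  ... | true  = refl
  ... | false = refl

  countᵇ-++ : (P : A → Bool) (xs ys : List A) → countᵇ P (xs ++ ys) ≡ countᵇ P xs + countᵇ P ys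
  countᵇ-++ P xs ys = trans (cong length (filter-++ (T? ∘ P) xs ys)) (length-++ (filterᵇ P xs))


  countᵇ-cong : {P Q : A → Bool} {L : List A} → All (λ a → P a ≡ Q a) L → countᵇ P L ≡ countᵇ Q L
  countᵇ-cong {P} {Q} {[]}     []       = refl
  countᵇ-cong {P} {Q} {x ∷ xs} (e ∷ es) = begin
      countᵇ P (x ∷ xs)              ≡⟨ countᵇ-cons P x xs ⟩
      indicator (P x) + countᵇ P xs  ≡⟨ cong₂ _+_ (cong indicator e) (countᵇ-cong es) ⟩
      indicator (Q x) + countᵇ Q xs  ≡⟨ countᵇ-cons Q x xs ⟨
      countᵇ Q (x ∷ xs)              ∎
    where open ≡-Reasoning

  countᵇ-all : {P : A → Bool} {L : List A} → All (λ a → P a ≡ true) L → countᵇ P L ≡ length L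
  countᵇ-all {P} {[]}     []       = refl
  countᵇ-all {P} {x ∷ xs} (e ∷ es) =
    trans (countᵇ-cons P x xs) (cong₂ (λ b k → indicator b + k) e (countᵇ-all es))

  countᵇ-const : (b : Bool) (L : List A) → countᵇ (λ _ → b) L ≡ indicator b * length L
  countᵇ-const b []       = sym (*-zeroʳ (indicator b))
  countᵇ-const b (x ∷ xs) =
    trans (countᵇ-cons (λ _ → b) x xs)
          (trans (cong (indicator b +_) (countᵇ-const b xs)) (sym (*-suc (indicator b) (length xs))))

  countᵇ-≤ : (P : A → Bool) (L : List A) → countᵇ P L ≤ length L
  countᵇ-≤ P L = length-filter (T? ∘ P) L


module _ {A B : Set} where

  sumOver-map : (g : B → ℕ) (f : A → B) (L : List A) → sumOver g (map f L) ≡ sumOver (g ∘ f) L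
  sumOver-map g f []      = refl
  sumOver-map g f (x ∷ L) = cong (g (f x) +_) (sumOver-map g f L)

  sumOver-concatMap : (g : B → ℕ) (f : A → List B) (L : List A) →
                      sumOver g (concatMap f L) ≡ sumOver (sumOver g ∘ f) L
  sumOver-concatMap g f []      = refl
  sumOver-concatMap g f (a ∷ L) =
    trans (sumOver-++ g (f a) (concatMap f L)) (cong (sumOver g (f a) +_) (sumOver-concatMap g f L))

  length-concatMap : (f : A → List B) (L : List A) → length (concatMap f L) ≡ sumOver (length ∘ f) L
  length-concatMap f []      = refl
  length-concatMap f (a ∷ L) = trans (length-++ (f a)) (cong (length (f a) +_) (length-concatMap f L))

  countᵇ-map : (P : B → Bool) (f : A → B) (L : List A) → countᵇ P (map f L) ≡ countᵇ (P ∘ f) L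
  countᵇ-map P f []       = refl
  countᵇ-map P f (x ∷ xs) =
    trans (countᵇ-cons P (f x) (map f xs))
          (trans (cong (indicator (P (f x)) +_) (countᵇ-map P f xs)) (sym (countᵇ-cons (P ∘ f) x xs)))

  All-concatMap : {P : B → Set} {f : A → List B} {L : List A} → All (All P ∘ f) L → All P (concatMap f L)
  All-concatMap = concat⁺ ∘ map⁺

-- Boolean comparison of naturals

<ᵇ-true : ∀ {m n} → m < n → (m <ᵇ n) ≡ true
<ᵇ-true {m} {n} m<n with m <ᵇ n | <⇒<ᵇ m<n
... | true  | _  = refl
... | false | ()

<ᵇ-false : ∀ {m n} → n ≤ m → (m <ᵇ n) ≡ false
<ᵇ-false {m} {n} n≤m with m <ᵇ n in eq
... | false = refl
... | true  = ⊥-elim (<⇒≱ (<ᵇ⇒< m n (subst T (sym eq) tt)) n≤m)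

<ᵇ-false⇒≥ : ∀ m n → (m <ᵇ n) ≡ false → n ≤ m
<ᵇ-false⇒≥ m n eq with ≤-<-connex n m
... | inj₁ n≤m = n≤m
... | inj₂ m<n with () ← trans (sym (<ᵇ-true m<n)) eq

+-<ᵇ : ∀ c a b → ((c + a) <ᵇ (c + b)) ≡ (a <ᵇ b)
+-<ᵇ zero    a b = refl
+-<ᵇ (suc c) a b = +-<ᵇ c a b

<ᵇ-trichotomy : ∀ {x y} → x ≢ y → indicator (x <ᵇ y) + indicator (y <ᵇ x) ≡ 1
<ᵇ-trichotomy {x} {y} x≢y with <-cmp x y
... | tri< x<y _ _   rewrite <ᵇ-true x<y | <ᵇ-false {y} {x} (<⇒≤ x<y) = refl
... | tri≈ _ x≡y _   = ⊥-elim (x≢y x≡y)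
... | tri> _ _ y<x   rewrite <ᵇ-true y<x | <ᵇ-false {x} {y} (<⇒≤ y<x) = refl

-- Ascent counts X^{12}

crossAscents : List ℕ → List ℕ → ℕ
crossAscents xs ys = sumOver (λ a → countᵇ (a <ᵇ_) ys) xs

X12-++ : (xs ys : List ℕ) → X12 (xs ++ ys) ≡ X12 xs + X12 ys + crossAscents xs ys
X12-++ []       ys = sym (+-identityʳ (X12 ys))
X12-++ (x ∷ xs) ys = begin
    countᵇ (x <ᵇ_) (xs ++ ys) + X12 (xs ++ ys)
      ≡⟨ cong₂ _+_ (countᵇ-++ (x <ᵇ_) xs ys) (X12-++ xs ys) ⟩
    (countᵇ (x <ᵇ_) xs + countᵇ (x <ᵇ_) ys) + (X12 xs + X12 ys + crossAscents xs ys)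
      ≡⟨ regroup (countᵇ (x <ᵇ_) xs) (countᵇ (x <ᵇ_) ys) (X12 xs) (X12 ys) (crossAscents xs ys) ⟩
    countᵇ (x <ᵇ_) xs + X12 xs + X12 ys + (countᵇ (x <ᵇ_) ys + crossAscents xs ys) ∎
  where
    open ≡-Reasoning
    regroup : ∀ a b x y c → (a + b) + (x + y + c) ≡ a + x + y + (b + c)
    regroup = solve-∀

X12-shift : (c : ℕ) (L : List ℕ) → X12 (map (c +_) L) ≡ X12 L
X12-shift c []       = refl
X12-shift c (x ∷ xs) =
  cong₂ _+_ (trans (countᵇ-map ((c + x) <ᵇ_) (c +_) xs) (countᵇ-cong (All.universal (+-<ᵇ c x) xs)))
            (X12-shift c xs)

X12-bound : (L : List ℕ) → X12 L ≤ length L * length L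
X12-bound []       = z≤n
X12-bound (x ∷ xs) = begin
    countᵇ (x <ᵇ_) xs + X12 xs  ≤⟨ +-mono-≤ (countᵇ-≤ (x <ᵇ_) xs) (X12-bound xs) ⟩
    k + k * k                   ≤⟨ m≤m+n (k + k * k) (suc k) ⟩
    k + k * k + suc k           ≡⟨ square k ⟩
    suc k * suc k               ∎
  where
    open ≤-Reasoning
    k : ℕ
    k = length xs
    square : ∀ k → k + k * k + suc k ≡ suc k * suc k
    square = solve-∀

countᵇ-above+below : ∀ {x} (xs : List ℕ) → All (x ≢_) xs →
                     countᵇ (x <ᵇ_) xs + countᵇ (_<ᵇ x) xs ≡ length xs
countᵇ-above+below []       []           = refl
countᵇ-above+below {x} (y ∷ ys) (x≢y ∷ x≢ys) =
  trans (cong₂ _+_ (countᵇ-cons (x <ᵇ_) y ys) (countᵇ-cons (_<ᵇ x) y ys))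
        (step (x <ᵇ y) (y <ᵇ x) (<ᵇ-trichotomy x≢y) (countᵇ-above+below ys x≢ys))
  where
    step : ∀ b₁ b₂ {A B k} → indicator b₁ + indicator b₂ ≡ 1 → A + B ≡ k →
           (indicator b₁ + A) + (indicator b₂ + B) ≡ suc k
    step true  false _  e = cong suc e
    step false true  {A} {B} _  e = trans (+-suc A B) (cong suc e)
    step true  true  ()
    step false false ()

-- Complementarity: in a list of distinct numbers every pair of positions
-- is either an ascent or a descent, so X^{12} + X^{21} = k(k-1)/2.
X12+X21 : (L : List ℕ) → Unique L → 2 * (X12 L + X21 L) + length L ≡ length L * length L
X12+X21 []       []             = refl
X12+X21 (x ∷ xs) (x≢xs ∷ uniq) =
  step {countᵇ (x <ᵇ_) xs} {countᵇ (_<ᵇ x) xs} {X12 xs} {X21 xs}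
       (countᵇ-above+below xs x≢xs) (X12+X21 xs uniq)
  where
    step : ∀ {A B X Y k} → A + B ≡ k → 2 * (X + Y) + k ≡ k * k →
           2 * ((A + X) + (B + Y)) + suc k ≡ suc k * suc k
    step {A} {B} {X} {Y} {k} refl IH = trans (expand A B X Y) (trans (cong (λ s → 2 * (A + B) + s + 1) IH) (square (A + B)))
      where
        expand : ∀ A B X Y → 2 * ((A + X) + (B + Y)) + suc (A + B) ≡ 2 * (A + B) + (2 * (X + Y) + (A + B)) + 1
        expand = solve-∀
        square : ∀ k → 2 * k + k * k + 1 ≡ suc k * suc k
        square = solve-∀

-- Ascents of a tensor product

block : ℕ → ℕ → List ℕ → List ℕ
block n s ρ = map (n * s +_) ρ

length-tensor : (n : ℕ) (σ ρ : List ℕ) → length (tensor n σ ρ) ≡ length σ * length ρ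
length-tensor n []      ρ = refl
length-tensor n (s ∷ σ) ρ =
  trans (length-++ (block n s ρ)) (cong₂ _+_ (length-map (n * s +_) ρ) (length-tensor n σ ρ))

-- Entries of different blocks compare like the corresponding entries of σ:
-- the block index dominates the offset r < n.
block-< : ∀ {n s s' r r'} → r < n → s < s' → n * s + r < n * s' + r'
block-< {n} {s} {s'} {r} {r'} r<n s<s' = begin-strict
  n * s + r   <⟨ +-monoʳ-< (n * s) r<n ⟩
  n * s + n   ≡⟨ trans (+-comm (n * s) n) (sym (*-suc n s)) ⟩
  n * suc s   ≤⟨ *-monoʳ-≤ n s<s' ⟩
  n * s'      ≤⟨ m≤m+n (n * s') r' ⟩
  n * s' + r' ∎
  where open ≤-Reasoning

block-<ᵇ : ∀ {n s s' r r'} → r < n → r' < n → s ≢ s' → ((n * s + r) <ᵇ (n * s' + r')) ≡ (s <ᵇ s')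
block-<ᵇ r<n r'<n s≢s' with <-cmp _ _
... | tri< s<s' _ _ = trans (<ᵇ-true (block-< r<n s<s')) (sym (<ᵇ-true s<s'))
... | tri≈ _ s≡s' _ = ⊥-elim (s≢s' s≡s')
... | tri> _ _ s'<s = trans (<ᵇ-false (<⇒≤ (block-< r'<n s'<s))) (sym (<ᵇ-false (<⇒≤ s'<s)))

module TensorAscents {n : ℕ} {ρ : List ℕ} (ρ<n : All (_< n) ρ) (|ρ|≡n : length ρ ≡ n) where

  -- An entry n·s + r of the block of s lies below exactly n entries of each
  -- block of an entry of σ above s, and below none of the other blocks.
  countᵇ-tensor : ∀ {s r} → r < n → (σ : List ℕ) → All (s ≢_) σ →
                  countᵇ ((n * s + r) <ᵇ_) (tensor n σ ρ) ≡ n * countᵇ (s <ᵇ_) σ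
  countᵇ-tensor         r<n []       []           = sym (*-zeroʳ n)
  countᵇ-tensor {s} {r} r<n (s' ∷ σ) (s≢s' ∷ s≢σ) = begin
      countᵇ (a <ᵇ_) (block n s' ρ ++ tensor n σ ρ)
        ≡⟨ countᵇ-++ (a <ᵇ_) (block n s' ρ) (tensor n σ ρ) ⟩
      countᵇ (a <ᵇ_) (block n s' ρ) + countᵇ (a <ᵇ_) (tensor n σ ρ)
        ≡⟨ cong₂ _+_ inBlock (countᵇ-tensor r<n σ s≢σ) ⟩
      indicator (s <ᵇ s') * n + n * countᵇ (s <ᵇ_) σ
        ≡⟨ factor (indicator (s <ᵇ s')) n (countᵇ (s <ᵇ_) σ) ⟩
      n * (indicator (s <ᵇ s') + countᵇ (s <ᵇ_) σ)
        ≡⟨ cong (n *_) (countᵇ-cons (s <ᵇ_) s' σ) ⟨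
      n * countᵇ (s <ᵇ_) (s' ∷ σ) ∎
    where
      open ≡-Reasoning
      a : ℕ
      a = n * s + r
      inBlock : countᵇ (a <ᵇ_) (block n s' ρ) ≡ indicator (s <ᵇ s') * n
      inBlock = begin
        countᵇ (a <ᵇ_) (block n s' ρ)        ≡⟨ countᵇ-map (a <ᵇ_) (n * s' +_) ρ ⟩
        countᵇ (λ r' → a <ᵇ (n * s' + r')) ρ  ≡⟨ countᵇ-cong (All.map (λ r'<n → block-<ᵇ r<n r'<n s≢s') ρ<n) ⟩
        countᵇ (λ _ → s <ᵇ s') ρ              ≡⟨ countᵇ-const (s <ᵇ s') ρ ⟩
        indicator (s <ᵇ s') * length ρ        ≡⟨ cong (indicator (s <ᵇ s') *_) |ρ|≡n ⟩
        indicator (s <ᵇ s') * n               ∎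
      factor : ∀ b n c → b * n + n * c ≡ n * (b + c)
      factor = solve-∀

  X12-tensor : (σ : List ℕ) → Unique σ → X12 (tensor n σ ρ) ≡ n * n * X12 σ + length σ * X12 ρ
  X12-tensor []       []           = sym (trans (+-identityʳ (n * n * 0)) (*-zeroʳ (n * n)))
  X12-tensor (s ∷ σ) (s≢σ ∷ uniq) = begin
      X12 (block n s ρ ++ tensor n σ ρ)
        ≡⟨ X12-++ (block n s ρ) (tensor n σ ρ) ⟩
      X12 (block n s ρ) + X12 (tensor n σ ρ) + crossAscents (block n s ρ) (tensor n σ ρ)
        ≡⟨ cong₂ (λ a b → a + b + crossAscents (block n s ρ) (tensor n σ ρ)) (X12-shift (n * s) ρ) (X12-tensor σ uniq) ⟩
      X12 ρ + (n * n * X12 σ + length σ * X12 ρ) + crossAscents (block n s ρ) (tensor n σ ρ)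
        ≡⟨ cong (X12 ρ + (n * n * X12 σ + length σ * X12 ρ) +_) across ⟩
      X12 ρ + (n * n * X12 σ + length σ * X12 ρ) + n * (n * countᵇ (s <ᵇ_) σ)
        ≡⟨ regroup n (X12 ρ) (X12 σ) (length σ) (countᵇ (s <ᵇ_) σ) ⟩
      n * n * (countᵇ (s <ᵇ_) σ + X12 σ) + suc (length σ) * X12 ρ ∎
    where
      open ≡-Reasoning
      across : crossAscents (block n s ρ) (tensor n σ ρ) ≡ n * (n * countᵇ (s <ᵇ_) σ)
      across = begin
        crossAscents (block n s ρ) (tensor n σ ρ)
          ≡⟨ sumOver-map (λ a → countᵇ (a <ᵇ_) (tensor n σ ρ)) (n * s +_) ρ ⟩
        sumOver (λ r → countᵇ ((n * s + r) <ᵇ_) (tensor n σ ρ)) ρ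
          ≡⟨ sumOver-const (All.map (λ r<n → countᵇ-tensor r<n σ s≢σ) ρ<n) ⟩
        length ρ * (n * countᵇ (s <ᵇ_) σ)
          ≡⟨ cong (_* (n * countᵇ (s <ᵇ_) σ)) |ρ|≡n ⟩
        n * (n * countᵇ (s <ᵇ_) σ) ∎
      regroup : ∀ n R X l c → R + (n * n * X + l * R) + n * (n * c) ≡ n * n * (c + X) + suc l * R
      regroup = solve-∀

-- The enumeration of S_n and its total number of ascents

insertAll-length : (x : ℕ) (ys : List ℕ) → length (insertAll x ys) ≡ suc (length ys)
insertAll-length x []       = refl
insertAll-length x (y ∷ ys) = cong suc (trans (length-map (y ∷_) (insertAll x ys)) (insertAll-length x ys))

insertAll-lengths : (x : ℕ) (ys : List ℕ) → All (λ ρ → length ρ ≡ suc (length ys)) (insertAll x ys)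
insertAll-lengths x []       = refl ∷ []
insertAll-lengths x (y ∷ ys) = refl ∷ map⁺ (All.map (cong suc) (insertAll-lengths x ys))

insertAll-entries : {P : ℕ → Set} {x : ℕ} {ys : List ℕ} → P x → All P ys → All (All P) (insertAll x ys)
insertAll-entries px []         = (px ∷ []) ∷ []
insertAll-entries px (py ∷ pys) = (px ∷ py ∷ pys) ∷ map⁺ (All.map (py ∷_) (insertAll-entries px pys))

insertAll-countᵇ : {P : ℕ → Bool} {x : ℕ} (ys : List ℕ) → P x ≡ false →
                   All (λ ρ → countᵇ P ρ ≡ countᵇ P ys) (insertAll x ys)
insertAll-countᵇ {P} {x} []       Px = trans (countᵇ-cons P x []) (cong (λ b → indicator b + 0) Px) ∷ []
insertAll-countᵇ {P} {x} (y ∷ ys) Px =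
  trans (countᵇ-cons P x (y ∷ ys)) (cong (λ b → indicator b + countᵇ P (y ∷ ys)) Px) ∷
  map⁺ (All.map (λ {ρ} e → trans (countᵇ-cons P y ρ) (trans (cong (indicator (P y) +_) e) (sym (countᵇ-cons P y ys))))
                (insertAll-countᵇ ys Px))

-- Inserting a minimum x into ys at position i creates |ys| − i new ascents,
-- so over all insertion positions:  2·Σ X^{12} = k(k+1) + 2(k+1)·X^{12}(ys).
insertAll-ascents : (x : ℕ) (ys : List ℕ) → All (x <_) ys →
                    2 * sumOver X12 (insertAll x ys) ≡ length ys * suc (length ys) + 2 * suc (length ys) * X12 ys
insertAll-ascents x []       []           = refl
insertAll-ascents x (y ∷ ys) (x<y ∷ x<ys) = begin
    2 * (X12 (x ∷ y ∷ ys) + sumOver X12 (map (y ∷_) I))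
      ≡⟨ cong₂ (λ a b → 2 * (a + b)) firstPosition laterPositions ⟩
    2 * ((suc k + (c + X)) + (suc k * c + 1 * S))
      ≡⟨ regroup k c X S ⟩
    2 * (suc k + (c + X) + suc k * c) + 2 * S
      ≡⟨ cong (2 * (suc k + (c + X) + suc k * c) +_) (insertAll-ascents x ys x<ys) ⟩
    2 * (suc k + (c + X) + suc k * c) + (k * suc k + 2 * suc k * X)
      ≡⟨ collect k c X ⟩
    suc k * suc (suc k) + 2 * suc (suc k) * (c + X) ∎
  where
    open ≡-Reasoning
    I : List (List ℕ)
    I = insertAll x ys
    k c X S : ℕ
    k = length ys
    c = countᵇ (y <ᵇ_) ys
    X = X12 ys
    S = sumOver X12 I
    -- x in front: it is below all the k + 1 other entries.
    firstPosition : X12 (x ∷ y ∷ ys) ≡ suc k + (c + X)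
    firstPosition = cong (_+ (c + X)) (countᵇ-all (All.map <ᵇ-true (x<y ∷ x<ys)))
    -- y in front: it keeps its c ascents, since x is not above y.
    laterPositions : sumOver X12 (map (y ∷_) I) ≡ suc k * c + 1 * S
    laterPositions = begin
      sumOver X12 (map (y ∷_) I)  ≡⟨ sumOver-map X12 (y ∷_) I ⟩
      sumOver (X12 ∘ (y ∷_)) I    ≡⟨ sumOver-affine c 1 (All.map (λ e → cong₂ _+_ e (sym (*-identityˡ _)))
                                                                  (insertAll-countᵇ ys (<ᵇ-false (<⇒≤ x<y)))) ⟩
      length I * c + 1 * S        ≡⟨ cong (λ l → l * c + 1 * S) (insertAll-length x ys) ⟩
      suc k * c + 1 * S           ∎
    regroup : ∀ k c X S → 2 * ((suc k + (c + X)) + (suc k * c + 1 * S)) ≡ 2 * (suc k + (c + X) + suc k * c) + 2 * S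
    regroup = solve-∀
    collect : ∀ k c X → 2 * (suc k + (c + X) + suc k * c) + (k * suc k + 2 * suc k * X) ≡ suc k * suc (suc k) + 2 * suc (suc k) * (c + X)
    collect = solve-∀

perms-entries : {P : ℕ → Set} {L : List ℕ} → All P L → All (All P) (perms L)
perms-entries []         = [] ∷ []
perms-entries (px ∷ pxs) = All-concatMap (All.map (insertAll-entries px) (perms-entries pxs))

perms-lengths : (L : List ℕ) → All (λ ρ → length ρ ≡ length L) (perms L)
perms-lengths []       = refl ∷ []
perms-lengths (x ∷ xs) =
  All-concatMap (All.map (λ {ρ} e → All.map (λ e' → trans e' (cong suc e)) (insertAll-lengths x ρ)) (perms-lengths xs))

perms-count : (L : List ℕ) → length (perms L) ≡ length L !
perms-count []       = refl
perms-count (x ∷ xs) = begin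
    length (concatMap (insertAll x) (perms xs))     ≡⟨ length-concatMap (insertAll x) (perms xs) ⟩
    sumOver (length ∘ insertAll x) (perms xs)       ≡⟨ sumOver-const (All.map (λ {ρ} e → trans (insertAll-length x ρ) (cong suc e))
                                                                              (perms-lengths xs)) ⟩
    length (perms xs) * suc (length xs)             ≡⟨ cong (_* suc (length xs)) (perms-count xs) ⟩
    length xs ! * suc (length xs)                   ≡⟨ *-comm (length xs !) (suc (length xs)) ⟩
    suc (length xs) * length xs !                   ∎
  where open ≡-Reasoning

-- The mean number of ascents of a permutation of k increasing entries is
-- k(k-1)/4:  4·Σ_ρ X^{12}(ρ) + k!·k = k!·k².
perms-ascents : (L : List ℕ) → AllPairs _<_ L → 4 * sumOver X12 (perms L) + length L ! * length L ≡ length L ! * length L * length L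
perms-ascents []       []             = refl
perms-ascents (x ∷ xs) (x<xs ∷ incr) = +-cancelʳ-≡ (suc k * (F * k)) _ _ (begin
    4 * sumOver X12 (concatMap (insertAll x) P) + suc k * F * suc k + suc k * (F * k)
      ≡⟨ cong (λ t → 4 * t + suc k * F * suc k + suc k * (F * k)) (sumOver-concatMap X12 (insertAll x) P) ⟩
    4 * total + suc k * F * suc k + suc k * (F * k)
      ≡⟨ quadruple total k F ⟩
    2 * (2 * total) + suc k * F * suc k + suc k * (F * k)
      ≡⟨ cong (λ t → 2 * t + suc k * F * suc k + suc k * (F * k)) doubled ⟩
    2 * (F * (k * suc k) + 2 * suc k * A) + suc k * F * suc k + suc k * (F * k)
      ≡⟨ regroup F k A ⟩
    2 * (F * (k * suc k)) + suc k * (4 * A + F * k) + suc k * F * suc k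
      ≡⟨ cong (λ t → 2 * (F * (k * suc k)) + suc k * t + suc k * F * suc k) (perms-ascents xs incr) ⟩
    2 * (F * (k * suc k)) + suc k * (F * k * k) + suc k * F * suc k
      ≡⟨ collect F k ⟩
    suc k * F * suc k * suc k + suc k * (F * k) ∎)
  where
    open ≡-Reasoning
    P : List (List ℕ)
    P = perms xs
    k F A total : ℕ
    k = length xs
    F = k !
    A = sumOver X12 P
    total = sumOver (sumOver X12 ∘ insertAll x) P
    perPermutation : All (λ ρ → 2 * sumOver X12 (insertAll x ρ) ≡ k * suc k + 2 * suc k * X12 ρ) P
    perPermutation = All.zipWith
      (λ {ρ} (e , x<ρ) → subst (λ l → 2 * sumOver X12 (insertAll x ρ) ≡ l * suc l + 2 * suc l * X12 ρ) e
                                (insertAll-ascents x ρ x<ρ))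
      (perms-lengths xs , perms-entries x<xs)
    doubled : 2 * total ≡ F * (k * suc k) + 2 * suc k * A
    doubled = begin
      2 * total                                                ≡⟨ sumOver-scale 2 (sumOver X12 ∘ insertAll x) P ⟨
      sumOver (λ ρ → 2 * sumOver X12 (insertAll x ρ)) P    ≡⟨ sumOver-affine (k * suc k) (2 * suc k) perPermutation ⟩
      length P * (k * suc k) + 2 * suc k * A               ≡⟨ cong (λ l → l * (k * suc k) + 2 * suc k * A) (perms-count xs) ⟩
      F * (k * suc k) + 2 * suc k * A                      ∎
    quadruple : ∀ s k F → 4 * s + suc k * F * suc k + suc k * (F * k) ≡ 2 * (2 * s) + suc k * F * suc k + suc k * (F * k)
    quadruple = solve-∀
    regroup : ∀ F k A → 2 * (F * (k * suc k) + 2 * suc k * A) + suc k * F * suc k + suc k * (F * k) ≡ 2 * (F * (k * suc k)) + suc k * (4 * A + F * k) + suc k * F * suc k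
    regroup = solve-∀
    collect : ∀ F k → 2 * (F * (k * suc k)) + suc k * (F * k * k) + suc k * F * suc k ≡ suc k * F * suc k * suc k + suc k * (F * k)
    collect = solve-∀

allPerms-entries : (n : ℕ) → All (All (_< n)) (allPerms n)
allPerms-entries n = perms-entries (applyUpTo⁺₁ id n id)

allPerms-lengths : (n : ℕ) → All (λ ρ → length ρ ≡ n) (allPerms n)
allPerms-lengths n = All.map (λ e → trans e (length-upTo n)) (perms-lengths (upTo n))

allPerms-count : (n : ℕ) → length (allPerms n) ≡ n !
allPerms-count n = trans (perms-count (upTo n)) (cong _! (length-upTo n))

allPerms-ascents : (n : ℕ) → 4 * sumOver X12 (allPerms n) + n ! * n ≡ n ! * n * n
allPerms-ascents n = subst (λ k → 4 * sumOver X12 (allPerms n) + k ! * k ≡ k ! * k * k) (length-upTo n)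
                           (perms-ascents (upTo n) (AllPairs.applyUpTo⁺₁ id n (λ i<j _ → i<j)))

-- Deviation of a sum from its nominal value

∣-∣-+-subadditive : ∀ a b c d → ∣ a + b - c + d ∣ ≤ ∣ a - c ∣ + ∣ b - d ∣
∣-∣-+-subadditive a b c d = begin
    ∣ a + b - c + d ∣                    ≤⟨ ∣-∣-triangle (a + b) (a + d) (c + d) ⟩
    ∣ a + b - a + d ∣ + ∣ a + d - c + d ∣  ≡⟨ cong₂ _+_ (∣m+n-m+o∣≡∣n-o∣ a b d) dropCommon ⟩
    ∣ b - d ∣ + ∣ a - c ∣                  ≡⟨ +-comm ∣ b - d ∣ ∣ a - c ∣ ⟩
    ∣ a - c ∣ + ∣ b - d ∣                  ∎
  where
    open ≤-Reasoning
    dropCommon : ∣ a + d - c + d ∣ ≡ ∣ a - c ∣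
    dropCommon = trans (cong₂ ∣_-_∣ (+-comm a d) (+-comm c d)) (∣m+n-m+o∣≡∣n-o∣ d a c)

module Deviation {A : Set} (T : A → ℕ) (c : ℕ) where

  deviation : A → ℕ
  deviation a = ∣ T a - c ∣

  sum-deviation : (L : List A) → ∣ sumOver T L - length L * c ∣ ≤ sumOver deviation L
  sum-deviation []      = ≤-refl
  sum-deviation (a ∷ L) = ≤-trans (∣-∣-+-subadditive (T a) (sumOver T L) c (length L * c))
                                  (+-monoʳ-≤ (deviation a) (sum-deviation L))

  module _ (p q : ℕ) where

    exceptional : A → Bool
    exceptional a = (p * c) <ᵇ (q * deviation a)

    -- Regular entries contribute at most p·c to q·Σ deviation, and the
    -- exceptional ones at most q·B, B being a bound on all deviations.
    deviation-split : (B : ℕ) (L : List A) → All (λ a → deviation a ≤ B) L →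
                      q * sumOver deviation L ≤ length L * (p * c) + countᵇ exceptional L * (q * B)
    deviation-split B []      []           = ≤-reflexive (*-zeroʳ q)
    deviation-split B (a ∷ L) (dev≤B ∷ bs) with exceptional a in e
    ... | true  = begin
        q * (deviation a + sumOver deviation L)           ≡⟨ *-distribˡ-+ q (deviation a) _ ⟩
        q * deviation a + q * sumOver deviation L         ≤⟨ +-mono-≤ (*-monoʳ-≤ q dev≤B) (deviation-split B L bs) ⟩
        q * B + (length L * (p * c) + k * (q * B))        ≤⟨ m≤n+m _ (p * c) ⟩
        p * c + (q * B + (length L * (p * c) + k * (q * B))) ≡⟨ regroup (p * c) (q * B) (length L * (p * c)) (k * (q * B)) ⟩
        (p * c + length L * (p * c)) + (q * B + k * (q * B)) ∎
      where
        open ≤-Reasoning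
        k : ℕ
        k = countᵇ exceptional L
        regroup : ∀ x y z w → x + (y + (z + w)) ≡ (x + z) + (y + w)
        regroup = solve-∀
    ... | false = begin
        q * (deviation a + sumOver deviation L)           ≡⟨ *-distribˡ-+ q (deviation a) _ ⟩
        q * deviation a + q * sumOver deviation L         ≤⟨ +-mono-≤ (<ᵇ-false⇒≥ (p * c) (q * deviation a) e)
                                                                       (deviation-split B L bs) ⟩
        p * c + (length L * (p * c) + k * (q * B))        ≡⟨ +-assoc (p * c) _ _ ⟨
        p * c + length L * (p * c) + k * (q * B)          ∎
      where
        open ≤-Reasoning
        k : ℕ
        k = countᵇ exceptional L

    sum-deviation-bound : (B : ℕ) (L : List A) → All (λ a → deviation a ≤ B) L →
                          q * ∣ sumOver T L - length L * c ∣ ≤ length L * (p * c) + countᵇ exceptional L * (q * B)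
    sum-deviation-bound B L bounded = ≤-trans (*-monoʳ-≤ q (sum-deviation L)) (deviation-split B L bounded)

-- The two arithmetic estimates

-- Here S is a total satisfying  S + m·F·n = F·n²·(4x) + m·F·n²  with m = j + 1
-- (this is the total of 4·X^{12}(σ ⊗ ρ) over ρ ∈ S_n, with F = n!).
module MeanGap (j n F x S : ℕ)
               (total : S + suc j * F * n ≡ F * (4 * (n * n * x)) + suc j * (F * n * n)) where

  m u K Δ : ℕ
  m = suc j
  u = F * n * n
  K = F * ((m * n) * (m * n))
  Δ = ∣ S - K ∣

  private
    total′ : u * (4 * x) + m * u ≡ S + m * F * n
    total′ = trans (regroup F n x m) (sym total)
      where
        regroup : ∀ F n x m → F * n * n * (4 * x) + m * (F * n * n) ≡ F * (4 * (n * n * x)) + m * (F * n * n)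
        regroup = solve-∀

  -- Above the symmetric value: S ≥ K + u − m·F·n, and m·F·n ≤ u/2 once n ≥ 2m.
  gap-above : suc (m * j) ≤ 4 * x → 2 * m ≤ n → u ≤ 2 * Δ
  gap-above 4x>mj 2m≤n = +-cancelˡ-≤ u u (2 * Δ) (begin
      u + u                             ≤⟨ +-mono-≤ u≤Δ+mFn u≤Δ+mFn ⟩
      (Δ + m * F * n) + (Δ + m * F * n) ≡⟨ regroup Δ (m * F * n) ⟩
      2 * (m * F * n) + 2 * Δ           ≤⟨ +-monoˡ-≤ (2 * Δ) 2mFn≤u ⟩
      u + 2 * Δ                         ∎)
    where
      open ≤-Reasoning
      u≤Δ+mFn : u ≤ Δ + m * F * n
      u≤Δ+mFn = +-cancelˡ-≤ K u (Δ + m * F * n) (begin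
        K + u                  ≡⟨ squares j n F ⟩
        u * suc (m * j) + m * u ≤⟨ +-monoˡ-≤ (m * u) (*-monoʳ-≤ u 4x>mj) ⟩
        u * (4 * x) + m * u    ≡⟨ total′ ⟩
        S + m * F * n          ≤⟨ +-monoˡ-≤ (m * F * n) (m≤n+∣m-n∣ S K) ⟩
        K + Δ + m * F * n      ≡⟨ +-assoc K Δ (m * F * n) ⟩
        K + (Δ + m * F * n)    ∎)
        where
          squares : ∀ j n F → F * ((suc j * n) * (suc j * n)) + F * n * n
                              ≡ F * n * n * suc (suc j * j) + suc j * (F * n * n)
          squares = solve-∀
      2mFn≤u : 2 * (m * F * n) ≤ u
      2mFn≤u = begin
        2 * (m * F * n) ≡⟨ reorder m F n ⟩
        F * (2 * m * n) ≤⟨ *-monoʳ-≤ F (*-monoˡ-≤ n 2m≤n) ⟩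
        F * (n * n)     ≡⟨ *-assoc F n n ⟨
        u               ∎
        where
          reorder : ∀ m F n → 2 * (m * F * n) ≡ F * (2 * m * n)
          reorder = solve-∀
      regroup : ∀ d e → (d + e) + (d + e) ≡ 2 * e + 2 * d
      regroup = solve-∀

  -- Below the symmetric value: S ≤ K − u − m·F·n.
  gap-below : suc (4 * x) ≤ m * j → u ≤ 2 * Δ
  gap-below 4x<mj = ≤-trans (m≤n+m u (m * F * n)) (≤-trans mFn+u≤Δ (m≤m+n Δ (Δ + 0)))
    where
      open ≤-Reasoning
      mFn+u≤Δ : m * F * n + u ≤ Δ
      mFn+u≤Δ = +-cancelˡ-≤ S (m * F * n + u) Δ (begin
        S + (m * F * n + u)      ≡⟨ +-assoc S (m * F * n) u ⟨
        S + m * F * n + u        ≡⟨ cong (_+ u) total′ ⟨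
        u * (4 * x) + m * u + u  ≡⟨ shift u (4 * x) m ⟩
        u * suc (4 * x) + m * u  ≤⟨ +-monoˡ-≤ (m * u) (*-monoʳ-≤ u 4x<mj) ⟩
        u * (m * j) + m * u      ≡⟨ squares j n F ⟩
        K                        ≤⟨ m≤n+∣m-n∣ K S ⟩
        S + ∣ K - S ∣            ≡⟨ cong (S +_) (∣-∣-comm K S) ⟩
        S + Δ                    ∎)
        where
          shift : ∀ u y m → u * y + m * u + u ≡ u * suc y + m * u
          shift = solve-∀
          squares : ∀ j n F → F * n * n * (suc j * j) + suc j * (F * n * n) ≡ F * ((suc j * n) * (suc j * n))
          squares = solve-∀

  mean-gap : 4 * x ≢ m * j → 2 * m ≤ n → u ≤ 2 * Δ
  mean-gap 4x≢mj 2m≤n with <-cmp (4 * x) (m * j)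
  ... | tri< 4x<mj _ _ = gap-below 4x<mj
  ... | tri≈ _ 4x≡mj _ = ⊥-elim (4x≢mj 4x≡mj)
  ... | tri> _ _ 4x>mj = gap-above 4x>mj 2m≤n

-- Concentration with tolerance 1/(4m²), fewer than F/(32m²) exceptional
-- values, and all deviations at most 4N², bounds the deviation of the total
-- by about 3F·n²/8; this is incompatible with a gap of F·n²/2 unless N = 0.
concentration-vs-gap : ∀ m n F bad Δ → let N² = (m * n) * (m * n) in
  suc (bad * (32 * m * m)) ≤ F →
  4 * m * m * Δ ≤ F * (1 * N²) + bad * (4 * m * m * (4 * N²)) →
  F * n * n ≤ 2 * Δ →
  N² ≡ 0
concentration-vs-gap m n F bad Δ fewExceptional concentrated gap =
  n≤0⇒n≡0 (+-cancelˡ-≤ (4 * (F * N²)) N² 0 (begin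
    4 * (F * N²) + N²                                    ≡⟨ cong (_+ N²) (units m n F) ⟩
    4 * m * m * (F * n * n) + N²                         ≤⟨ +-monoˡ-≤ N² (*-monoʳ-≤ (4 * m * m) gap) ⟩
    4 * m * m * (2 * Δ) + N²                             ≡⟨ cong (_+ N²) (swap (4 * m * m) Δ) ⟩
    2 * (4 * m * m * Δ) + N²                             ≤⟨ +-monoˡ-≤ N² (*-monoʳ-≤ 2 concentrated) ⟩
    2 * (F * (1 * N²) + bad * (4 * m * m * (4 * N²))) + N² ≡⟨ collect F N² bad m ⟩
    2 * (F * N²) + suc (bad * (32 * m * m)) * N²         ≤⟨ +-monoʳ-≤ (2 * (F * N²)) (*-monoˡ-≤ N² fewExceptional) ⟩
    2 * (F * N²) + F * N²                                ≤⟨ +-monoʳ-≤ (2 * (F * N²)) (m≤m+n (F * N²) (F * N²)) ⟩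
    2 * (F * N²) + (F * N² + F * N²)                     ≡⟨ four (F * N²) ⟩
    4 * (F * N²) + 0                                     ∎))
  where
    open ≤-Reasoning
    N² : ℕ
    N² = (m * n) * (m * n)
    units : ∀ m n F → 4 * (F * ((m * n) * (m * n))) ≡ 4 * m * m * (F * n * n)
    units = solve-∀
    swap : ∀ a d → a * (2 * d) ≡ 2 * (a * d)
    swap = solve-∀
    collect : ∀ F N b m → 2 * (F * (1 * N) + b * (4 * m * m * (4 * N))) + N ≡ 2 * (F * N) + suc (b * (32 * m * m)) * N
    collect = solve-∀
    four : ∀ M → 2 * M + (M + M) ≡ 4 * M + 0
    four = solve-∀

IsPerm⇒Unique : ∀ {m σ} → IsPerm m σ → Unique σ
IsPerm⇒Unique {m} σ↭ = SetoidPerm.Unique-resp-↭ (setoid ℕ) (↭⇒↭ₛ (↭-sym σ↭)) (upTo⁺ m)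

IsPerm⇒length : ∀ {m σ} → IsPerm m σ → length σ ≡ m
IsPerm⇒length {m} σ↭ = trans (↭-length σ↭) (length-upTo m)

tensor-ascents : ∀ {m n ρ} σ → IsPerm m σ → All (_< n) ρ → length ρ ≡ n →
                 4 * X12 (tensor n σ ρ) ≡ 4 * (n * n * X12 σ) + 4 * m * X12 ρ
tensor-ascents {m} {n} {ρ} σ σ-perm ρ<n |ρ|≡n = begin
    4 * X12 (tensor n σ ρ)                        ≡⟨ cong (4 *_) (TensorAscents.X12-tensor ρ<n |ρ|≡n σ (IsPerm⇒Unique σ-perm)) ⟩
    4 * (n * n * X12 σ + length σ * X12 ρ)        ≡⟨ cong (λ l → 4 * (n * n * X12 σ + l * X12 ρ)) (IsPerm⇒length σ-perm) ⟩
    4 * (n * n * X12 σ + m * X12 ρ)               ≡⟨ distribute 4 (n * n * X12 σ) m (X12 ρ) ⟩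
    4 * (n * n * X12 σ) + 4 * m * X12 ρ           ∎
  where
    open ≡-Reasoning
    distribute : ∀ a b m r → a * (b + m * r) ≡ a * b + a * m * r
    distribute = solve-∀

tensor-ascent-total : ∀ {m} n σ → IsPerm m σ →
  sumOver (λ ρ → 4 * X12 (tensor n σ ρ)) (allPerms n) + m * n ! * n ≡ n ! * (4 * (n * n * X12 σ)) + m * (n ! * n * n)
tensor-ascent-total {m} n σ σ-perm = begin
    sumOver (λ ρ → 4 * X12 (tensor n σ ρ)) (allPerms n) + m * F * n
      ≡⟨ cong (_+ m * F * n) (sumOver-affine (4 * (n * n * x)) (4 * m) perPermutation) ⟩
    length (allPerms n) * (4 * (n * n * x)) + 4 * m * A + m * F * n
      ≡⟨ cong (λ l → l * (4 * (n * n * x)) + 4 * m * A + m * F * n) (allPerms-count n) ⟩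
    F * (4 * (n * n * x)) + 4 * m * A + m * F * n
      ≡⟨ regroup F (4 * (n * n * x)) m A n ⟩
    F * (4 * (n * n * x)) + m * (4 * A + F * n)
      ≡⟨ cong (λ t → F * (4 * (n * n * x)) + m * t) (allPerms-ascents n) ⟩
    F * (4 * (n * n * x)) + m * (F * n * n) ∎
  where
    open ≡-Reasoning
    F x A : ℕ
    F = n !
    x = X12 σ
    A = sumOver X12 (allPerms n)
    perPermutation : All (λ ρ → 4 * X12 (tensor n σ ρ) ≡ 4 * (n * n * x) + 4 * m * X12 ρ) (allPerms n)
    perPermutation = All.zipWith (λ (ρ<n , |ρ|≡n) → tensor-ascents σ σ-perm ρ<n |ρ|≡n)
                                 (allPerms-entries n , allPerms-lengths n)
    regroup : ∀ F a m A n → F * a + 4 * m * A + m * F * n ≡ F * a + m * (4 * A + F * n)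
    regroup = solve-∀

-- Every value 4·X^{12}(σ ⊗ ρ) lies in [0, 4N²], so it deviates from N² by at most 4N².
tensor-deviation-bounded : ∀ {m} n σ → IsPerm m σ →
  All (λ ρ → ∣ 4 * X12 (tensor n σ ρ) - (m * n) * (m * n) ∣ ≤ 4 * ((m * n) * (m * n))) (allPerms n)
tensor-deviation-bounded {m} n σ σ-perm = All.map bounded (allPerms-lengths n)
  where
    N² : ℕ
    N² = (m * n) * (m * n)
    bounded : ∀ {ρ} → length ρ ≡ n → ∣ 4 * X12 (tensor n σ ρ) - N² ∣ ≤ 4 * N²
    bounded {ρ} |ρ|≡n = ≤-trans (∣m-n∣≤m⊔n (4 * X12 (tensor n σ ρ)) N²) (⊔-lub value≤4N² (m≤n*m N² 4))
      where
        |t|≡N : length (tensor n σ ρ) ≡ m * n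
        |t|≡N = trans (length-tensor n σ ρ) (cong₂ _*_ (IsPerm⇒length σ-perm) |ρ|≡n)
        value≤4N² : 4 * X12 (tensor n σ ρ) ≤ 4 * N²
        value≤4N² = *-monoʳ-≤ 4 (subst (λ l → X12 (tensor n σ ρ) ≤ l * l) |t|≡N (X12-bound (tensor n σ ρ)))

square-nonzero : ∀ j i → (suc j * suc i) * (suc j * suc i) ≢ 0
square-nonzero j i ()

module Concentration (j : ℕ) (σ : List ℕ) (σ-perm : IsPerm (suc j) σ) (conv : ConvInProbTo1 X12 (suc j) σ) where

  m : ℕ
  m = suc j

  -- Tolerance ε = 1/q and confidence δ = 1/r; n is beyond the threshold n₀
  -- they give, and at least 2m.
  q r : ℕ
  q = 4 * m * m
  r = 32 * m * m

  threshold : Σ ℕ λ n₀ → ∀ n → n₀ ≤ n → 1 ≤ n → badCount X12 m σ 1 q n * r < 1 * n !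
  threshold = conv 1 q 1 r z<s z<s z<s z<s

  n : ℕ
  n = suc (proj₁ threshold + 2 * m)

  N² F S bad : ℕ
  N² = (m * n) * (m * n)
  F = n !
  S = sumOver (λ ρ → 4 * X12 (tensor n σ ρ)) (allPerms n)
  bad = badCount X12 m σ 1 q n

  few-exceptional : suc (bad * r) ≤ F
  few-exceptional = subst (suc (bad * r) ≤_) (*-identityˡ F)
                          (proj₂ threshold n (≤-trans (m≤m+n _ (2 * m)) (n≤1+n _)) (s≤s z≤n))

  deviation-small : q * ∣ S - F * N² ∣ ≤ F * (1 * N²) + bad * (q * (4 * N²))
  deviation-small = subst (λ k → q * ∣ S - k * N² ∣ ≤ k * (1 * N²) + bad * (q * (4 * N²))) (allPerms-count n)
    (Deviation.sum-deviation-bound (λ ρ → 4 * X12 (tensor n σ ρ)) N² 1 q (4 * N²) (allPerms n)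
                                   (tensor-deviation-bounded n σ σ-perm))

  deviation-large : 4 * X12 σ ≢ m * j → F * n * n ≤ 2 * ∣ S - F * N² ∣
  deviation-large 4x≢mj = MeanGap.mean-gap j n F (X12 σ) S (tensor-ascent-total n σ σ-perm) 4x≢mj
                                           (≤-trans (m≤n+m (2 * m) _) (n≤1+n _))

  balanced : 4 * X12 σ ≡ m * j
  balanced with 4 * X12 σ ≟ m * j
  ... | yes 4x≡mj = 4x≡mj
  ... | no  4x≢mj = ⊥-elim (square-nonzero j (proj₁ threshold + 2 * m)
                              (concentration-vs-gap m n F bad ∣ S - F * N² ∣
                                                    few-exceptional deviation-small (deviation-large 4x≢mj)))

other-half : ∀ j a b → 2 * (a + b) + suc j ≡ suc j * suc j → 4 * a ≡ suc j * j → 4 * b ≡ suc j * j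
other-half j a b total quarter = +-cancelˡ-≡ (suc j * j) _ _ (begin
    suc j * j + 4 * b          ≡⟨ cong (_+ 4 * b) quarter ⟨
    4 * a + 4 * b              ≡⟨ double a b ⟩
    2 * (a + b) + 2 * (a + b)  ≡⟨ cong (λ t → t + t) half ⟩
    suc j * j + suc j * j      ∎)
  where
    open ≡-Reasoning
    square : ∀ j → suc j * suc j ≡ suc j * j + suc j
    square = solve-∀
    half : 2 * (a + b) ≡ suc j * j
    half = +-cancelʳ-≡ (suc j) _ _ (trans total (square j))
    double : ∀ a b → 4 * a + 4 * b ≡ 2 * (a + b) + 2 * (a + b)
    double = solve-∀

proposition1 : (m : ℕ) → 1 ≤ m → (σ : List ℕ) → IsPerm m σ →
    AsympTwoSymTensor m σ →
    (X12 σ ≡ X21 σ) × (4 * X12 σ ≡ m * (m ∸ 1)) × (4 * X21 σ ≡ m * (m ∸ 1))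
proposition1 zero    ()
proposition1 (suc j) _  σ σ-perm (conv12 , _) = X12≡X21 , balanced , balanced21
  where
    open Concentration j σ σ-perm conv12 using (balanced)
    complement : 2 * (X12 σ + X21 σ) + suc j ≡ suc j * suc j
    complement = subst (λ k → 2 * (X12 σ + X21 σ) + k ≡ k * k) (IsPerm⇒length σ-perm)
                       (X12+X21 σ (IsPerm⇒Unique σ-perm))
    balanced21 : 4 * X21 σ ≡ suc j * j
    balanced21 = other-half j (X12 σ) (X21 σ) complement balanced
    X12≡X21 : X12 σ ≡ X21 σ
    X12≡X21 = *-cancelˡ-≡ (X12 σ) (X21 σ) 4 (trans balanced (sym balanced21))
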